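{- Let $U$ be a set and $S,P,M\subseteq U$, and write $X'=U\setminus X$. Call a PCP ("pair of categorical premises") any pair consisting of a P-premise, which is a statement $E(M^*,P^*)$ or $I(M^*,P^*)$ with $M^*\in\{M,M'\}$, $P^*\in\{P,P'\}$, and an S-premise, which is a statement $E(M^\circ,S^*)$ or $I(M^\circ,S^*)$ with $M^\circ\in\{M,M'\}$, $S^*\in\{S,S'\}$ (so there are $8\times 8=64$ formally distinct PCPs). Say that a PCP entails a logical consequence (LC) if at least one of the following holds: (i) there is a region $R$ (one of the eight sets $S^\dagger\cap P^\dagger\cap M^\dagger$ with $S^\dagger\in\{S,S'\}$, $P^\dagger\in\{P,P'\}$, $M^\dagger\in\{M,M'\}$) such that $R\neq\emptyset$ for every set $U$ and every choice of $S,P,M\subseteq U$ satisfying both premises; or (ii) there is $X\in\{S,S',P,P',M,M'\}$ and a region $R\subseteq X$ such that $X=R$ (i.e. the other three regions contained in $X$ are empty) for every $U,S,P,M$ satisfying both premises. Then exactly 32 of the 64 PCPs entail an LC, namely exactly those of the forms (1) $E(M^*,P^*)\,E(M^{*\prime},S^*)$, (2) $E(M^*,P^*)\,E(M^*,S^*)$, (3a) $E(M^*,P^*)\,I(M^*,S^*)$, (3b) $I(M^*,P^*)\,E(M^*,S^*)$, with $M^*\in\{M,M'\}$, $P^*\in\{P,P'\}$, $S^*\in\{S,S'\}$ (here $M^{*\prime}$ is the complement of $M^*$). The remaining 32 PCPs, of the forms $I(M^*,P^*)I(M^*,S^*)$, $I(M^*,P^*)I(M^{*\prime},S^*)$, $E(M^*,P^*)I(M^{*\prime},S^*)$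 and $I(M^*,P^*)E(M^{*\prime},S^*)$, entail no LC.
   Context: For $X,Y\subseteq U$: $E(X,Y)$ means $X\cap Y=\emptyset$ ("No $X$ is $Y$"), $I(X,Y)$ means $X\cap Y\neq\emptyset$ ("Some $X$ is $Y$"), $A(X,Y)$ means $E(X,Y')$ ("All $X$ is $Y$"), $O(X,Y)$ means $I(X,Y')$ ("Some $X$ is not $Y$"). The complement of $M'$ is $M$, etc. -}

module Defs where

open import Data.Bool using (Bool; true; false; not; _∧_; _∨_; if_then_else_; T)
open import Data.Product using (Σ; ∃; _×_; _,_)
open import Data.Sum using (_⊎_)
open import Data.Empty using (⊥)
open import Data.List using (List; []; _∷_; _++_; map; concatMap)
open import Relation.Binary.PropositionalEquality using (_≡_)
open import Function using (_⇔_)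

-- Sets and subsets.  A subset of a universe U is a Bool-valued
-- predicate (classical subsets: membership is decided, so X'' = X).

Subset : Set → Set
Subset U = U → Bool

_∈_ : {U : Set} → U → Subset U → Set
x ∈ X = X x ≡ true

lit : {U : Set} → Bool → Subset U → Subset U
lit true  X = X
lit false X = λ x → not (X x)

_∩_ : {U : Set} → Subset U → Subset U → Subset U
(X ∩ Y) x = X x ∧ Y x

Empty : {U : Set} → Subset U → Set
Empty {U} X = (x : U) → x ∈ X → ⊥

NonEmpty : {U : Set} → Subset U → Set
NonEmpty {U} X = Σ U (λ x → x ∈ X)

E : {U : Set} → Subset U → Subset U → Set
E X Y = Empty (X ∩ Y)

I : {U : Set} → Subset U → Subset U → Set
I X Y = NonEmpty (X ∩ Y)

A : {U : Set} → Subset U → Subset U → Set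
A X Y = E X (lit false Y)

O : {U : Set} → Subset U → Subset U → Set
O X Y = I X (lit false Y)

record Model : Set₁ where
  field
    U : Set
    S P M : Subset U
open Model public

data Quant : Set where
  qE qI : Quant

⟦_⟧q : Quant → {U : Set} → Subset U → Subset U → Set
⟦ qE ⟧q = E
⟦ qI ⟧q = I

-- A PCP: P-premise  pq(M^pm, P^pp)  and  S-premise  sq(M^sm, S^ss),
-- where a polarity true means the set itself, false its complement.
record PCP : Set where
  constructor pcp
  field
    pq : Quant
    pm : Bool
    pp : Bool
    sq : Quant
    sm : Bool
    ss : Bool
open PCP public

Satisfies : Model → PCP → Set
Satisfies 𝔐 c =
  ⟦ pq c ⟧q (lit (pm c) (M 𝔐)) (lit (pp c) (P 𝔐)) ×
  ⟦ sq c ⟧q (lit (sm c) (M 𝔐)) (lit (ss c) (S 𝔐))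

record Region : Set where
  constructor region
  field
    rs rp rm : Bool
open Region public

regionSet : (𝔐 : Model) → Region → Subset (U 𝔐)
regionSet 𝔐 r = lit (rs r) (S 𝔐) ∩ (lit (rp r) (P 𝔐) ∩ lit (rm r) (M 𝔐))

data Letter : Set where
  lS lP lM : Letter

record Term : Set where
  constructor term
  field
    letter : Letter
    pol    : Bool
open Term public

termSet : (𝔐 : Model) → Term → Subset (U 𝔐)
termSet 𝔐 (term lS b) = lit b (S 𝔐)
termSet 𝔐 (term lP b) = lit b (P 𝔐)
termSet 𝔐 (term lM b) = lit b (M 𝔐)

RegionIn : Region → Term → Set
RegionIn r (term lS b) = rs r ≡ b
RegionIn r (term lP b) = rp r ≡ b
RegionIn r (term lM b) = rm r ≡ b

_≐_ : {U : Set} → Subset U → Subset U → Set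
X ≐ Y = (∀ x → x ∈ X → x ∈ Y) × (∀ x → x ∈ Y → x ∈ X)

EntailsLC : PCP → Set₁
EntailsLC c =
  (Σ Region λ R → (𝔐 : Model) → Satisfies 𝔐 c → NonEmpty (regionSet 𝔐 R))
  ⊎
  (Σ Term λ X → Σ Region λ R → RegionIn R X ×
     ((𝔐 : Model) → Satisfies 𝔐 c → termSet 𝔐 X ≐ regionSet 𝔐 R))

data GoodForm : PCP → Set where
  form1  : ∀ m p s → GoodForm (pcp qE m p qE (not m) s)
  form2  : ∀ m p s → GoodForm (pcp qE m p qE m s)
  form3a : ∀ m p s → GoodForm (pcp qE m p qI m s)
  form3b : ∀ m p s → GoodForm (pcp qI m p qE m s)

_==_ : Bool → Bool → Bool
true  == b = b
false == b = not b

isGood : PCP → Bool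
isGood (pcp qE m p qE m' s) = true
isGood (pcp qE m p qI m' s) = m == m'
isGood (pcp qI m p qE m' s) = m == m'
isGood (pcp qI m p qI m' s) = false

bools : List Bool
bools = true ∷ false ∷ []

quants : List Quant
quants = qE ∷ qI ∷ []

allPCPs : List PCP
allPCPs =
  concatMap (λ a → concatMap (λ b → concatMap (λ c →
  concatMap (λ d → concatMap (λ e → map (λ f → pcp a b c d e f)
    bools) bools) quants) bools) bools) quants

module Submission where

open import Defs
open import Data.Product using (_×_)
open import Data.List using (length; filterᵇ)
open import Data.Bool using (T)
open import Data.Nat using (ℕ)
open import Relation.Binary.PropositionalEquality using (_≡_)

open import Data.Bool using (Bool; true; false; not; _∧_; _∨_)
open import Data.Bool.ListAction using (all; any)
open import Data.Bool.Properties using (not-involutive; ¬-not; not-¬; ∧-conicalˡ; ∧-conicalʳ; T-∧; T-∨; T-≡; T-not-≡)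
open import Data.Empty using (⊥-elim)
open import Data.List using (List; []; _∷_; map; cartesianProduct)
open import Data.List.Membership.Propositional using () renaming (_∈_ to _∈ₗ_)
open import Data.List.Membership.Propositional.Properties using (∈-cartesianProduct⁺; ∈-map⁺)
open import Data.List.Relation.Unary.All using () renaming (lookup to lookupAll)
open import Data.List.Relation.Unary.All.Properties using (all⁺)
open import Data.List.Relation.Unary.Any using (here; there; satisfied)
open import Data.List.Relation.Unary.Any.Properties using (any⁻)
open import Data.Product using (Σ; _,_; proj₁; proj₂)
open import Data.Sum using (inj₁; inj₂)
open import Data.Unit using (tt)
open import Function using (_∘_; Equivalence)
open import Relation.Nullary using (¬_)
open import Relation.Binary.PropositionalEquality using (refl; sym; trans; cong; cong₂; _≗_; subst)

-- Positive half: each of the forms (1), (2), (3a), (3b) is an instance of a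
-- syllogism about arbitrary sets X, Y, Z ⊆ U and their complements
-- (E-E′⇒determined, E-E⇒determined, E-I⇒inhabited, I-E⇒inhabited).  With
-- X = M*, Y = P*, Z = S* they force a region to be inhabited (3a, 3b), or
-- force S* resp. M* to coincide with one of its regions (1, 2).
--
-- Negative half: c entails no LC as soon as, for every region R, some model
-- of c leaves R empty while inhabiting each of S, S', P, P', M, M'
-- (refuted⇒noLC).  Such models are sought among region models, whose points
-- are a set K of regions; their properties are decided by Boolean evaluation
-- over the finitely many regions and terms (Listed, certifiesᴮ-sound).  The
-- candidate K for c and R keeps every region except R and those emptied by an
-- E-premise of c.  One exhaustive evaluation over all 64 PCPs
-- (classification) shows that every PCP satisfies the Boolean classifier
-- isGood or is refuted by these candidates; isGood agrees with GoodForm, and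
-- the counts 64 and 32 are computed directly.

Complement : {U : Set} → Subset U → Subset U → Set
Complement Y Y' = ∀ x → Y' x ≡ not (Y x)

lit-complement : {U : Set} (b : Bool) (X : Subset U) → Complement (lit b X) (lit (not b) X)
lit-complement true  X x = refl
lit-complement false X x = sym (not-involutive (X x))

-- x ∈ X → x ∈ Y → x ∈ X ∩ Y, stated on the truth values X x and Y x
-- (from which Agda recovers them).
∩-intro : {a b : Bool} → a ≡ true → b ≡ true → a ∧ b ≡ true
∩-intro = cong₂ _∧_

module _ {U : Set} (X Y : Subset U) {x : U} where

  ∩-left : x ∈ (X ∩ Y) → x ∈ X
  ∩-left = ∧-conicalˡ (X x) (Y x)

  ∩-right : x ∈ (X ∩ Y) → x ∈ Y
  ∩-right = ∧-conicalʳ (X x) (Y x)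

module _ {U : Set} {X Y : Subset U} (x : U) where

  ∉⇒∈-complement : Complement X Y → ¬ x ∈ X → x ∈ Y
  ∉⇒∈-complement c x∉X = trans (c x) (cong not (¬-not x∉X))

  ∉-complement⇒∈ : Complement X Y → ¬ x ∈ Y → x ∈ X
  ∉-complement⇒∈ c x∉Y with X x in eq
  ... | true  = refl
  ... | false = ⊥-elim (x∉Y (trans (c x) (cong not eq)))

E⇒⊆complement : {U : Set} {X Y Y' : Subset U} → Complement Y Y' →
                E X Y → ∀ x → x ∈ X → x ∈ Y'
E⇒⊆complement cY noXY x x∈X = ∉⇒∈-complement x cY (λ x∈Y → noXY x (∩-intro x∈X x∈Y))

lit-∈ : {U : Set} (b : Bool) (X : Subset U) {x : U} → x ∈ lit b X → X x ≡ b
lit-∈ true  X x∈X = x∈X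
lit-∈ false X x∈X' = trans (sym (not-involutive _)) (cong not x∈X')

E-E′⇒determined : {U : Set} {X X' Y Y' Z : Subset U} → Complement X X' → Complement Y Y' →
                  E X Y → E X' Z → Z ≐ (Z ∩ (Y' ∩ X))
E-E′⇒determined {X = X} {Y' = Y'} {Z = Z} cX cY noXY noX'Z =
  (λ x x∈Z → let x∈X = ∉-complement⇒∈ x cX (λ x∈X' → noX'Z x (∩-intro x∈X' x∈Z))
             in ∩-intro x∈Z (∩-intro (E⇒⊆complement cY noXY x x∈X) x∈X))
  , λ x → ∩-left Z (Y' ∩ X)

E-E⇒determined : {U : Set} {X Y Y' Z Z' : Subset U} → Complement Y Y' → Complement Z Z' →
                 E X Y → E X Z → X ≐ (Z' ∩ (Y' ∩ X))
E-E⇒determined {X = X} {Y' = Y'} {Z' = Z'} cY cZ noXY noXZ =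
  (λ x x∈X → ∩-intro (E⇒⊆complement cZ noXZ x x∈X)
                       (∩-intro (E⇒⊆complement cY noXY x x∈X) x∈X))
  , λ x → ∩-right Y' X ∘ ∩-right Z' (Y' ∩ X)

E-I⇒inhabited : {U : Set} {X Y Y' Z : Subset U} → Complement Y Y' → E X Y → I X Z → NonEmpty (Z ∩ (Y' ∩ X))
E-I⇒inhabited {X = X} {Z = Z} cY noXY (x , x∈XZ) =
  let x∈X = ∩-left X Z x∈XZ in
  x , ∩-intro (∩-right X Z x∈XZ) (∩-intro (E⇒⊆complement cY noXY x x∈X) x∈X)

I-E⇒inhabited : {U : Set} {X Y Z Z' : Subset U} → Complement Z Z' → I X Y → E X Z → NonEmpty (Z' ∩ (Y ∩ X))
I-E⇒inhabited {X = X} {Y = Y} cZ (x , x∈XY) noXZ =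
  let x∈X = ∩-left X Y x∈XY in
  x , ∩-intro (E⇒⊆complement cZ noXZ x x∈X) (∩-intro (∩-right X Y x∈XY) x∈X)

goodForm⇒LC : ∀ c → GoodForm c → EntailsLC c
goodForm⇒LC _ (form1 m p s) =
  inj₂ (term lS s , region s (not p) m , refl , λ 𝔐 (noMP , noM'S) →
    E-E′⇒determined (lit-complement m (M 𝔐)) (lit-complement p (P 𝔐)) noMP noM'S)
goodForm⇒LC _ (form2 m p s) =
  inj₂ (term lM m , region (not s) (not p) m , refl , λ 𝔐 (noMP , noMS) →
    E-E⇒determined (lit-complement p (P 𝔐)) (lit-complement s (S 𝔐)) noMP noMS)
goodForm⇒LC _ (form3a m p s) =
  inj₁ (region s (not p) m , λ 𝔐 (noMP , someMS) →
    E-I⇒inhabited (lit-complement p (P 𝔐)) noMP someMS)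
goodForm⇒LC _ (form3b m p s) =
  inj₁ (region (not s) p m , λ 𝔐 (someMP , noMS) →
    I-E⇒inhabited (lit-complement s (S 𝔐)) someMP noMS)

Refutes : PCP → Region → Model → Set
Refutes c R 𝔐 = Satisfies 𝔐 c × Empty (regionSet 𝔐 R) × ((X : Term) → NonEmpty (termSet 𝔐 X))

-- Such a model for every region R rules out both kinds of LC: it shows
-- that R is not forced to be inhabited, and that no X is forced to equal R.
refuted⇒noLC : ∀ c → ((R : Region) → Σ Model (Refutes c R)) → ¬ EntailsLC c
refuted⇒noLC c refute (inj₁ (R , forced)) with refute R
... | 𝔐 , sat , R-empty , _ = let (x , x∈R) = forced 𝔐 sat in R-empty x x∈R
refuted⇒noLC c refute (inj₂ (X , R , _ , forced)) with refute R
... | 𝔐 , sat , R-empty , inhabited =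
  let (x , x∈X) = inhabited X in R-empty x (proj₁ (forced 𝔐 sat) x x∈X)

record Listed (A : Set) : Set where
  field
    elements : List A
    complete : ∀ a → a ∈ₗ elements

  ∀ᴮ : (A → Bool) → Bool
  ∀ᴮ f = all f elements

  ∀ᴮ-sound : ∀ f → T (∀ᴮ f) → ∀ a → T (f a)
  ∀ᴮ-sound f h a = lookupAll (all⁺ f elements h) (complete a)

  ∃ᴮ : (A → Bool) → Bool
  ∃ᴮ f = any f elements

  ∃ᴮ-sound : ∀ f → T (∃ᴮ f) → Σ A (T ∘ f)
  ∃ᴮ-sound f h = satisfied (any⁻ f elements h)

listedBool : Listed Bool
listedBool = record
  { elements = true ∷ false ∷ []
  ; complete = λ where
      true  → here refl
      false → there (here refl)
  }

listedQuant : Listed Quant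
listedQuant = record
  { elements = qE ∷ qI ∷ []
  ; complete = λ where
      qE → here refl
      qI → there (here refl)
  }

listedLetter : Listed Letter
listedLetter = record
  { elements = lS ∷ lP ∷ lM ∷ []
  ; complete = λ where
      lS → here refl
      lP → there (here refl)
      lM → there (there (here refl))
  }

_×ᴸ_ : {A B : Set} → Listed A → Listed B → Listed (A × B)
LA ×ᴸ LB = record
  { elements = cartesianProduct (Listed.elements LA) (Listed.elements LB)
  ; complete = λ (a , b) → ∈-cartesianProduct⁺ (Listed.complete LA a) (Listed.complete LB b)
  }

image : {A B : Set} → Listed A → (f : A → B) (g : B → A) → (∀ b → f (g b) ≡ b) → Listed B
image LA f g fg = record
  { elements = map f (Listed.elements LA)
  ; complete = λ b → subst (_∈ₗ map f (Listed.elements LA)) (fg b) (∈-map⁺ f (Listed.complete LA (g b)))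
  }

regions : Listed Region
regions = image (listedBool ×ᴸ (listedBool ×ᴸ listedBool))
  (λ (s , p , m) → region s p m) (λ r → rs r , rp r , rm r) (λ _ → refl)

terms : Listed Term
terms = image (listedLetter ×ᴸ listedBool) (λ (l , b) → term l b) (λ t → letter t , pol t) (λ _ → refl)

pcps : Listed PCP
pcps = image ((listedQuant ×ᴸ (listedBool ×ᴸ listedBool)) ×ᴸ (listedQuant ×ᴸ (listedBool ×ᴸ listedBool)))
  (λ ((a , b , c) , (d , e , f)) → pcp a b c d e f)
  (λ x → (pq x , pm x , pp x) , (sq x , sm x , ss x)) (λ _ → refl)

open Listed regions using () renaming (∀ᴮ to ∀ᴿ; ∀ᴮ-sound to ∀ᴿ-sound; ∃ᴮ to ∃ᴿ; ∃ᴮ-sound to ∃ᴿ-sound)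
open Listed terms using () renaming (∀ᴮ to ∀ᵀ; ∀ᴮ-sound to ∀ᵀ-sound)
open Listed pcps using () renaming (∀ᴮ-sound to ∀ᴾ-sound)

pointModel : Model
pointModel = record { U = Region ; S = rs ; P = rp ; M = rm }

-- The submodel of the point model on a set K of regions: exactly the
-- regions in K are inhabited, each by a single point.
regionModel : Subset Region → Model
regionModel K = record { U = Σ Region (_∈ K) ; S = rs ∘ proj₁ ; P = rp ∘ proj₁ ; M = rm ∘ proj₁ }

lit-∘ : {A B : Set} (b : Bool) (X : Subset A) (f : B → A) → lit b (X ∘ f) ≗ lit b X ∘ f
lit-∘ true  X f u = refl
lit-∘ false X f u = refl

⟦⟧-resp-≗ : ∀ q {U : Set} {X X' Y Y' : Subset U} → X ≗ X' → Y ≗ Y' → ⟦ q ⟧q X Y → ⟦ q ⟧q X' Y'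
⟦⟧-resp-≗ qE X≗X' Y≗Y' noXY x x∈X'Y' = noXY x (trans (cong₂ _∧_ (X≗X' x) (Y≗Y' x)) x∈X'Y')
⟦⟧-resp-≗ qI X≗X' Y≗Y' (x , x∈XY) = x , trans (sym (cong₂ _∧_ (X≗X' x) (Y≗Y' x))) x∈XY

∈region⇒polarities : ∀ 𝔐 R {x : U 𝔐} → x ∈ regionSet 𝔐 R →
                     S 𝔐 x ≡ rs R × P 𝔐 x ≡ rp R × M 𝔐 x ≡ rm R
∈region⇒polarities 𝔐 R {x} x∈R =
  lit-∈ (rs R) (S 𝔐) (∩-left Sᴿ (Pᴿ ∩ Mᴿ) x∈R) ,
  lit-∈ (rp R) (P 𝔐) (∩-left Pᴿ Mᴿ x∈PM) ,
  lit-∈ (rm R) (M 𝔐) (∩-right Pᴿ Mᴿ x∈PM)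
  where
  Sᴿ Pᴿ Mᴿ : Subset (U 𝔐)
  Sᴿ = lit (rs R) (S 𝔐)
  Pᴿ = lit (rp R) (P 𝔐)
  Mᴿ = lit (rm R) (M 𝔐)
  x∈PM : x ∈ (Pᴿ ∩ Mᴿ)
  x∈PM = ∩-right Sᴿ (Pᴿ ∩ Mᴿ) x∈R

region-≡ : {r R : Region} → rs r ≡ rs R → rp r ≡ rp R → rm r ≡ rm R → r ≡ R
region-≡ {region _ _ _} {region _ _ _} refl refl refl = refl

-- In a region model, the only point of region R is the point of R itself;
-- hence R is empty if it was not selected.
regionModel-empty : ∀ K R → K R ≡ false → Empty (regionSet (regionModel K) R)
regionModel-empty K R R∉K (r , r∈K) r∈R with ∈region⇒polarities (regionModel K) R r∈R
... | s≡ , p≡ , m≡ with region-≡ s≡ p≡ m≡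
... | refl = ⊥-elim (not-¬ r∈K R∉K)

termSet-regionModel : ∀ K X (u : U (regionModel K)) →
                      termSet (regionModel K) X u ≡ termSet pointModel X (proj₁ u)
termSet-regionModel K (term lS b) = lit-∘ b rs proj₁
termSet-regionModel K (term lP b) = lit-∘ b rp proj₁
termSet-regionModel K (term lM b) = lit-∘ b rm proj₁

inhabitedᴮ : Subset Region → Term → Bool
inhabitedᴮ K X = ∃ᴿ (K ∩ termSet pointModel X)

inhabitedᴮ-sound : ∀ K X → T (inhabitedᴮ K X) → NonEmpty (termSet (regionModel K) X)
inhabitedᴮ-sound K X h with ∃ᴿ-sound (K ∩ termSet pointModel X) h
... | r , t = let r∈ = Equivalence.to T-≡ t in
  (r , ∩-left K Xᴾ r∈) , trans (termSet-regionModel K X _) (∩-right K Xᴾ r∈)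
  where
  Xᴾ : Subset Region
  Xᴾ = termSet pointModel X

holdsᴮ : Subset Region → Quant → Subset Region → Subset Region → Bool
holdsᴮ K qE X Y = ∀ᴿ λ r → not ((K ∩ (X ∩ Y)) r)
holdsᴮ K qI X Y = ∃ᴿ (K ∩ (X ∩ Y))

holdsᴮ-sound : ∀ K q X Y → T (holdsᴮ K q X Y) → ⟦ q ⟧q {U (regionModel K)} (X ∘ proj₁) (Y ∘ proj₁)
holdsᴮ-sound K qE X Y h (r , r∈K) r∈XY =
  not-¬ (∩-intro r∈K r∈XY) (Equivalence.to T-not-≡ (∀ᴿ-sound (λ r → not ((K ∩ (X ∩ Y)) r)) h r))
holdsᴮ-sound K qI X Y h with ∃ᴿ-sound (K ∩ (X ∩ Y)) h
... | r , t = let r∈ = Equivalence.to T-≡ t in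
  (r , ∩-left K (X ∩ Y) r∈) , ∩-right K (X ∩ Y) r∈

premiseᴮ : Subset Region → Quant → Bool → Bool → Subset Region → Bool
premiseᴮ K q m y Y = holdsᴮ K q (lit m rm) (lit y Y)

premiseᴮ-sound : ∀ K q m y Y → T (premiseᴮ K q m y Y) →
                 ⟦ q ⟧q (lit m (rm ∘ proj₁)) (lit y (Y ∘ proj₁))
premiseᴮ-sound K q m y Y h =
  ⟦⟧-resp-≗ q (sym ∘ lit-∘ m rm proj₁) (sym ∘ lit-∘ y Y proj₁) (holdsᴮ-sound K q _ _ h)

satisfiesᴮ : Subset Region → PCP → Bool
satisfiesᴮ K c = premiseᴮ K (pq c) (pm c) (pp c) rp ∧ premiseᴮ K (sq c) (sm c) (ss c) rs

satisfiesᴮ-sound : ∀ K c → T (satisfiesᴮ K c) → Satisfies (regionModel K) c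
satisfiesᴮ-sound K c h =
  let (hP , hS) = Equivalence.to T-∧ h in
  premiseᴮ-sound K (pq c) (pm c) (pp c) rp hP , premiseᴮ-sound K (sq c) (sm c) (ss c) rs hS

certifiesᴮ : PCP → Region → Subset Region → Bool
certifiesᴮ c R K = not (K R) ∧ (satisfiesᴮ K c ∧ ∀ᵀ (inhabitedᴮ K))

certifiesᴮ-sound : ∀ c R K → T (certifiesᴮ c R K) → Refutes c R (regionModel K)
certifiesᴮ-sound c R K h =
  let (R∉K , h′) = Equivalence.to T-∧ h
      (sat , inhabited) = Equivalence.to T-∧ h′
  in satisfiesᴮ-sound K c sat
   , regionModel-empty K R (Equivalence.to T-not-≡ R∉K)
   , λ X → inhabitedᴮ-sound K X (∀ᵀ-sound (inhabitedᴮ K) inhabited X)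

emptiedBy : Quant → Bool → Bool → Subset Region → Subset Region
emptiedBy qE m y Y = lit m rm ∩ lit y Y
emptiedBy qI m y Y = λ _ → false

kernel : PCP → Region → Subset Region
kernel c R r =
  not (emptiedBy (pq c) (pm c) (pp c) rp r) ∧
  (not (emptiedBy (sq c) (sm c) (ss c) rs r) ∧ not (regionSet pointModel R r))

-- By exhaustive evaluation: every PCP is of one of the forms (1)–(3b),
-- or its kernels certify countermodels for every region.
classification : ∀ c → T (isGood c ∨ ∀ᴿ (λ R → certifiesᴮ c R (kernel c R)))
classification = ∀ᴾ-sound (λ c → isGood c ∨ ∀ᴿ (λ R → certifiesᴮ c R (kernel c R))) tt

isGood⇒goodForm : ∀ c → T (isGood c) → GoodForm c
isGood⇒goodForm (pcp qE true  p qE true  s) _ = form2 true p s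
isGood⇒goodForm (pcp qE false p qE false s) _ = form2 false p s
isGood⇒goodForm (pcp qE true  p qE false s) _ = form1 true p s
isGood⇒goodForm (pcp qE false p qE true  s) _ = form1 false p s
isGood⇒goodForm (pcp qE true  p qI true  s) _ = form3a true p s
isGood⇒goodForm (pcp qE false p qI false s) _ = form3a false p s
isGood⇒goodForm (pcp qI true  p qE true  s) _ = form3b true p s
isGood⇒goodForm (pcp qI false p qE false s) _ = form3b false p s
isGood⇒goodForm (pcp qE true  p qI false s) ()
isGood⇒goodForm (pcp qE false p qI true  s) ()
isGood⇒goodForm (pcp qI true  p qE false s) ()
isGood⇒goodForm (pcp qI false p qE true  s) ()
isGood⇒goodForm (pcp qI m     p qI m′    s) ()

goodForm⇒isGood : ∀ c → GoodForm c → T (isGood c)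
goodForm⇒isGood _ (form1 m p s)     = tt
goodForm⇒isGood _ (form2 m p s)     = tt
goodForm⇒isGood _ (form3a true p s)  = tt
goodForm⇒isGood _ (form3a false p s) = tt
goodForm⇒isGood _ (form3b true p s)  = tt
goodForm⇒isGood _ (form3b false p s) = tt

LC⇒goodForm : ∀ c → EntailsLC c → GoodForm c
LC⇒goodForm c lc with Equivalence.to T-∨ (classification c)
... | inj₁ good      = isGood⇒goodForm c good
... | inj₂ certified = ⊥-elim (refuted⇒noLC c countermodel lc)
  where
  countermodel : (R : Region) → Σ Model (Refutes c R)
  countermodel R = regionModel (kernel c R) ,
    certifiesᴮ-sound c R (kernel c R) (∀ᴿ-sound (λ R → certifiesᴮ c R (kernel c R)) certified R)

mainTheorem1 : ((c : PCP) → (EntailsLC c → GoodForm c) × (GoodForm c → EntailsLC c))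
    × ((c : PCP) → T (isGood c) → GoodForm c) × ((c : PCP) → GoodForm c → T (isGood c))
    × (length allPCPs ≡ 64) × (length (filterᵇ isGood allPCPs) ≡ 32)
mainTheorem1 =
  (λ c → LC⇒goodForm c , goodForm⇒LC c) ,
  isGood⇒goodForm , goodForm⇒isGood ,
  refl , refl
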